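{- Let $\Phi$ be a closed formula of the logic $\mathrm{HO}\mu^{1}_{2}$ (defined below) of size $k$, and let $\mathcal{T}_1,\mathcal{T}_2$ be two finite labeled transition systems, each of size at most $n$. Then the call $\textsc{MC}(\Phi,[])$ of the model checking algorithm described below correctly computes the semantics $[\![\emptyset \vdash \Phi : \mathrm{Pr}_2]\!]$ (the set of all pairs $(P_1,P_2)\in S_1\times S_2$ satisfying $\Phi$) with respect to $\mathcal{T}_1,\mathcal{T}_2$, in time $\mathcal{O}(n^2 \cdot 2^{n^2 k^2})$.
   Context: A labeled transition system (LTS) is a triple $\mathcal{T}=(S,\mathit{Act},\to)$ with a set of states (processes) $S$, a set of actions $\mathit{Act}$ and a transition relation $\to\,\subseteq S\times\mathit{Act}\times S$. The logic $\mathrm{HO}\mu$ combines the higher-order fixpoint logic HFL with the higher-dimensional $\mu$-calculus. Formulas are built by $\Phi ::= \top \mid \langle a\rangle_i\Phi \mid \neg\Phi \mid \Phi\wedge\Psi \mid x \mid \lambda x^{v}:\tau.\,\Phi \mid \mu x:\tau.\,\Phi \mid \Phi\ \Psi$, with variances $v\in\{+,-,\pm\}$ (monotone, antitone, arbitrary) and types $\tau ::= \mathrm{Pr}_d \mid \tau^{v}\to\sigma$; the order of $\tau_1^{v_1}\to\dots\to\tau_m^{v_m}\to\mathrm{Pr}_d$ is $\max\{1+\mathrm{ord}(\tau_i)\}$ (0 if $m=0$). A type system ensures well-typedness and that fixpoints are only taken of monotone functions. Over LTS $\mathcal{T}_1,\mathcal{T}_2$ with state sets $S_1,S_2$, $\mathrm{Pr}_2$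 denotes the lattice of subsets of $S_1\times S_2$, function types denote (monotone/antitone/all) functions ordered pointwise, $\langle a\rangle_i\Phi$ holds at a pair if its $i$-th component has an $a$-successor such that the pair with that component replaced satisfies $\Phi$, and $\mu$ denotes the least fixpoint. $\mathrm{HO}\mu^{1}_{2}$ is the set of closed formulas of type $\mathrm{Pr}_2$ all of whose type annotations have order at most 1, so every subformula has type $\mathrm{Pr}_2^{v_1}\to\dots\to\mathrm{Pr}_2^{v_m}\to\mathrm{Pr}_2$. Algorithm $\textsc{MC}(\Phi,\rho)$ computes semantics recursively over the structure of $\Phi$ under a variable interpretation $\rho$: $\top$ gives $S_1\times S_2$, boolean and modal operators are computed set-wise, a $\lambda$-abstraction of arity $m$ is computed as a full table over all $(T_1,\dots,T_m)\in(2^{S_1\times S_2})^m$, application applies the table to the computed arguments, and $\mu x.\Psi$ is computed by fixpoint iteration from the everywhere-empty table until stabilization. -}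

module Defs where

open import Data.Nat using (ℕ; zero; suc; _+_; _*_; _^_)
open import Data.Fin using (Fin)
import Data.Fin.Properties as FinP
open import Data.Vec using (Vec; []; _∷_; lookup; replicate; tabulate; zipWith)
import Data.Vec as V
import Data.Vec.Properties as VecP
open import Data.List using (List; []; _∷_; length; map; concatMap)
open import Data.Bool.ListAction using (all; any)
open import Data.Nat.ListAction using (sum)
open import Data.Bool using (Bool; true; false; not; _∧_; if_then_else_)
import Data.Bool.Properties as BoolP
open import Data.Product using (Σ; _×_; _,_; proj₁; proj₂)
open import Data.Unit using (⊤; tt)
open import Relation.Binary.PropositionalEquality using (_≡_)
open import Relation.Binary.Definitions using (DecidableEquality)
open import Relation.Nullary.Decidable using (⌊_⌋)
open import Data.List.Membership.Propositional using (_∈_)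
open import Function.Bundles using (_⇔_)

record LTS (Act : Set) : Set where
  field
    nSt   : ℕ
    trans : List (Fin nSt × Act × Fin nSt)

ltsSize : ∀ {Act} → LTS Act → ℕ
ltsSize T = LTS.nSt T + length (LTS.trans T)

-- variances: + (monotone), - (antitone), ± (arbitrary)
data Variance : Set where
  v+ v- v± : Variance

flipV : Variance → Variance
flipV v+ = v-
flipV v- = v+
flipV v± = v±

-- Types of HOμ¹₂: Pr₂^{v₁} → … → Pr₂^{vₘ} → Pr₂, represented by [v₁, …, vₘ].
-- ([] is Pr₂.)
Ty : Set
Ty = List Variance

data Comp : Set where
  c₁ c₂ : Comp

-- Formulas with m free variables (de Bruijn indices, well scoped).
-- lam v Φ  is  λ x^v : Pr₂. Φ ;   mu τ Φ  is  μ x : τ. Φ.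
data Fm (Act : Set) : ℕ → Set where
  tt   : ∀ {m} → Fm Act m
  dia  : ∀ {m} → Act → Comp → Fm Act m → Fm Act m
  neg  : ∀ {m} → Fm Act m → Fm Act m
  conj : ∀ {m} → Fm Act m → Fm Act m → Fm Act m
  var  : ∀ {m} → Fin m → Fm Act m
  lam  : ∀ {m} → Variance → Fm Act (suc m) → Fm Act m
  mu   : ∀ {m} → Ty → Fm Act (suc m) → Fm Act m
  app  : ∀ {m} → Fm Act m → Fm Act m → Fm Act m

size : ∀ {Act m} → Fm Act m → ℕ
size tt         = 1
size (dia _ _ Φ) = suc (size Φ)
size (neg Φ)    = suc (size Φ)
size (conj Φ Ψ) = suc (size Φ + size Ψ)
size (var _)    = 1
size (lam _ Φ)  = suc (size Φ)
size (mu _ Φ)   = suc (size Φ)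
size (app Φ Ψ)  = suc (size Φ + size Ψ)

flipAll : ∀ {m} → Vec Variance m → Vec Variance m
flipAll = V.map flipV

data Usable : Variance → Set where
  use+ : Usable v+
  use± : Usable v±

data _∣_⊢_∶_ {Act : Set} : ∀ {m} → Vec Ty m → Vec Variance m → Fm Act m → Ty → Set where
  t-tt   : ∀ {m} {Δ : Vec Ty m} {V} → Δ ∣ V ⊢ tt ∶ []
  t-dia  : ∀ {m} {Δ : Vec Ty m} {V} {a : Act} {i : Comp} {Φ} →
           Δ ∣ V ⊢ Φ ∶ [] → Δ ∣ V ⊢ dia a i Φ ∶ []
  t-neg  : ∀ {m} {Δ : Vec Ty m} {V} {Φ} →
           Δ ∣ flipAll V ⊢ Φ ∶ [] → Δ ∣ V ⊢ neg Φ ∶ []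
  t-conj : ∀ {m} {Δ : Vec Ty m} {V} {Φ Ψ} →
           Δ ∣ V ⊢ Φ ∶ [] → Δ ∣ V ⊢ Ψ ∶ [] → Δ ∣ V ⊢ conj Φ Ψ ∶ []
  t-var  : ∀ {m} {Δ : Vec Ty m} {V} (i : Fin m) →
           Usable (lookup V i) → Δ ∣ V ⊢ var i ∶ lookup Δ i
  t-lam  : ∀ {m} {Δ : Vec Ty m} {V} {v σ Φ} →
           ([] ∷ Δ) ∣ (v ∷ V) ⊢ Φ ∶ σ → Δ ∣ V ⊢ lam v Φ ∶ (v ∷ σ)
  t-mu   : ∀ {m} {Δ : Vec Ty m} {V} {τ Φ} →
           (τ ∷ Δ) ∣ (v+ ∷ V) ⊢ Φ ∶ τ → Δ ∣ V ⊢ mu τ Φ ∶ τ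
  t-app+ : ∀ {m} {Δ : Vec Ty m} {V} {σ Φ Ψ} →
           Δ ∣ V ⊢ Φ ∶ (v+ ∷ σ) → Δ ∣ V ⊢ Ψ ∶ [] → Δ ∣ V ⊢ app Φ Ψ ∶ σ
  t-app- : ∀ {m} {Δ : Vec Ty m} {V} {σ Φ Ψ} →
           Δ ∣ V ⊢ Φ ∶ (v- ∷ σ) → Δ ∣ flipAll V ⊢ Ψ ∶ [] → Δ ∣ V ⊢ app Φ Ψ ∶ σ
  t-app± : ∀ {m} {Δ : Vec Ty m} {V} {σ Φ Ψ} →
           Δ ∣ V ⊢ Φ ∶ (v± ∷ σ) → Δ ∣ V ⊢ Ψ ∶ [] → Δ ∣ flipAll V ⊢ Ψ ∶ [] →
           Δ ∣ V ⊢ app Φ Ψ ∶ σ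

all-vecs : ∀ {A : Set} (k : ℕ) → List A → List (Vec A k)
all-vecs zero    xs = [] ∷ []
all-vecs (suc k) xs = concatMap (λ x → map (x ∷_) (all-vecs k xs)) xs

module Semantics {Act : Set} (_≟A_ : DecidableEquality Act) (T₁ T₂ : LTS Act) where
  open LTS T₁ renaming (nSt to n₁; trans to tr₁)
  open LTS T₂ renaming (nSt to n₂; trans to tr₂)

  -- elements of Pr₂: subsets of S₁ × S₂ (as boolean matrices)
  PSet : Set
  PSet = Vec (Vec Bool n₂) n₁

  mem : PSet → Fin n₁ → Fin n₂ → Bool
  mem A p q = lookup (lookup A p) q

  _⊆_ : PSet → PSet → Set
  A ⊆ B = ∀ p q → mem A p q ≡ true → mem B p q ≡ true

  mutual
    Val : Ty → Set
    Val []      = PSet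
    Val (v ∷ σ) = Σ (PSet → Val σ) (Resp v σ)

    _⊑_ : ∀ {τ} → Val τ → Val τ → Set
    _⊑_ {[]}    A B = A ⊆ B
    _⊑_ {v ∷ σ} f g = ∀ T → proj₁ f T ⊑ proj₁ g T

    Resp : (v : Variance) (σ : Ty) → (PSet → Val σ) → Set
    Resp v+ σ f = ∀ T T′ → T ⊆ T′ → f T ⊑ f T′
    Resp v- σ f = ∀ T T′ → T ⊆ T′ → f T′ ⊑ f T
    Resp v± σ f = ⊤

  _≈_ : ∀ {τ} → Val τ → Val τ → Set
  x ≈ y = x ⊑ y × y ⊑ x

  Env : ∀ {m} → Vec Ty m → Set
  Env []      = ⊤
  Env (τ ∷ Δ) = Val τ × Env Δ

  lookupEnv : ∀ {m} {Δ : Vec Ty m} → Env Δ → (i : Fin m) → Val (lookup Δ i)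
  lookupEnv {Δ = τ ∷ Δ} (x , ρ) Fin.zero    = x
  lookupEnv {Δ = τ ∷ Δ} (x , ρ) (Fin.suc i) = lookupEnv ρ i

  -- Den d ρ w : w is the semantics [[Δ ⊢ Φ : τ]] ρ  (μ = least fixpoint
  -- in the lattice Val τ, characterised à la Knaster–Tarski)
  Den : ∀ {m} {Δ : Vec Ty m} {V} {Φ : Fm Act m} {τ} →
        Δ ∣ V ⊢ Φ ∶ τ → Env Δ → Val τ → Set
  Den t-tt ρ w = ∀ p q → mem w p q ≡ true
  Den (t-dia {a = a} {i = c₁} d) ρ w =
    Σ PSet λ u → Den d ρ u ×
      (∀ p q → (mem w p q ≡ true) ⇔
                (Σ (Fin n₁) λ p′ → ((p , a , p′) ∈ tr₁) × mem u p′ q ≡ true))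
  Den (t-dia {a = a} {i = c₂} d) ρ w =
    Σ PSet λ u → Den d ρ u ×
      (∀ p q → (mem w p q ≡ true) ⇔
                (Σ (Fin n₂) λ q′ → ((q , a , q′) ∈ tr₂) × mem u p q′ ≡ true))
  Den (t-neg d) ρ w =
    Σ PSet λ u → Den d ρ u × (∀ p q → mem w p q ≡ not (mem u p q))
  Den (t-conj d e) ρ w =
    Σ PSet λ u → Σ PSet λ u′ → Den d ρ u × Den e ρ u′ ×
      (∀ p q → mem w p q ≡ (mem u p q ∧ mem u′ p q))
  Den (t-var i _) ρ w = w ≈ lookupEnv ρ i
  Den (t-lam d) ρ w = ∀ T → Den d (T , ρ) (proj₁ w T)
  Den (t-mu d) ρ w =
    Den d (w , ρ) w × (∀ f f′ → Den d (f , ρ) f′ → f′ ⊑ f → w ⊑ f)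
  Den (t-app+ {σ = σ} d e) ρ w =
    Σ (Val (v+ ∷ σ)) λ f → Σ PSet λ t → Den d ρ f × Den e ρ t × proj₁ f t ≈ w
  Den (t-app- {σ = σ} d e) ρ w =
    Σ (Val (v- ∷ σ)) λ f → Σ PSet λ t → Den d ρ f × Den e ρ t × proj₁ f t ≈ w
  Den (t-app± {σ = σ} d e _) ρ w =
    Σ (Val (v± ∷ σ)) λ f → Σ PSet λ t → Den d ρ f × Den e ρ t × proj₁ f t ≈ w

  data Sem : Set where
    set : PSet → Sem
    fun : (PSet → Sem) → Sem

  allSets : List PSet
  allSets = all-vecs n₁ (all-vecs n₂ (false ∷ true ∷ []))

  N : ℕ
  N = n₁ * n₂

  -- number of bits of a table of arity k: |S₁×S₂| · (2^{|S₁×S₂|})^k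
  tableSize : ℕ → ℕ
  tableSize k = N * length allSets ^ k

  emptySet topSet : PSet
  emptySet = replicate n₁ (replicate n₂ false)
  topSet   = replicate n₁ (replicate n₂ true)

  asSet : Sem → PSet
  asSet (set A) = A
  asSet (fun _) = emptySet

  botSem : ℕ → Sem
  botSem zero    = set emptySet
  botSem (suc k) = fun (λ _ → botSem k)

  eqSem : ℕ → Sem → Sem → Bool
  eqSem zero    (set A) (set B) = ⌊ VecP.≡-dec (VecP.≡-dec BoolP._≟_) A B ⌋
  eqSem (suc k) (fun f) (fun g) = all (λ T → eqSem k (f T) (g T)) allSets
  eqSem _       _       _       = false

  applySem : Sem → Sem → Sem
  applySem (fun f) (set T) = f T
  applySem _       _       = botSem zero

  diaSet : Act → Comp → PSet → PSet
  diaSet a c₁ u = tabulate λ p → tabulate λ q →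
    any (λ t → ⌊ FinP._≟_ (proj₁ t) p ⌋ ∧ ⌊ proj₁ (proj₂ t) ≟A a ⌋ ∧ mem u (proj₂ (proj₂ t)) q) tr₁
  diaSet a c₂ u = tabulate λ p → tabulate λ q →
    any (λ t → ⌊ FinP._≟_ (proj₁ t) q ⌋ ∧ ⌊ proj₁ (proj₂ t) ≟A a ⌋ ∧ mem u p (proj₂ (proj₂ t))) tr₂

  transCount : Comp → ℕ
  transCount c₁ = length tr₁
  transCount c₂ = length tr₂

  -- fixpoint iteration with a fuel bound (tableSize k + 1 suffices for a
  -- monotone functional on tables of arity k); stops at stabilisation
  iterate : ℕ → (Sem → Sem × ℕ) → ℕ → Sem → Sem × ℕ
  iterate k step zero     f = f , 0
  iterate k step (suc fu) f =
    let r = step f in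
    if eqSem k (proj₁ r) f
      then (f , proj₂ r + tableSize k)
      else (let r′ = iterate k step fu (proj₁ r) in
            proj₁ r′ , proj₂ r + tableSize k + proj₂ r′)

  -- MC Φ ρ = (computed value , number of steps)
  MC : ∀ {m} → Fm Act m → Vec Sem m → Sem × ℕ
  MC tt ρ = set topSet , N
  MC (dia a i Φ) ρ =
    let r = MC Φ ρ in set (diaSet a i (asSet (proj₁ r))) , proj₂ r + N * suc (transCount i)
  MC (neg Φ) ρ =
    let r = MC Φ ρ in set (V.map (V.map not) (asSet (proj₁ r))) , proj₂ r + N
  MC (conj Φ Ψ) ρ =
    let r = MC Φ ρ ; r′ = MC Ψ ρ in
    set (zipWith (zipWith _∧_) (asSet (proj₁ r)) (asSet (proj₁ r′))) , proj₂ r + proj₂ r′ + N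
  MC (var i) ρ = lookup ρ i , 1
  MC (lam v Φ) ρ =
    fun (λ T → proj₁ (MC Φ (set T ∷ ρ))) ,
    sum (map (λ T → proj₂ (MC Φ (set T ∷ ρ))) allSets)
  MC (mu τ Φ) ρ =
    iterate (length τ) (λ f → MC Φ (f ∷ ρ)) (suc (tableSize (length τ))) (botSem (length τ))
  MC (app Φ Ψ) ρ =
    let r = MC Φ ρ ; r′ = MC Ψ ρ in
    applySem (proj₁ r) (proj₁ r′) , proj₂ r + proj₂ r′ + N

module Submission where

-- MC is related to the semantics by a logical relation: a computed set
-- represents itself, and a computed table represents a function when each of
-- its entries represents the corresponding value. By induction on typing
-- derivations, MC returns a representative of the semantics; simultaneously,
-- the semantics is monotone in each free variable according to its variance.
-- For μ x. Ψ, the iterates from the empty table form an increasing chain of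
-- post-fixpoints below every pre-fixpoint, and the number of true bits of a
-- table grows strictly until stabilisation while staying below its total
-- number of bits; so the fuel suffices and the stable iterate is the least
-- fixpoint. For the running time, the cost of a subformula of size s whose
-- type has arity a is at most n² · Q^(s² + 2sa) with Q = 2^(n²): a table of
-- arity a has at most n² · Q^a bits, a fixpoint is iterated at most that often,
-- and going from size s to s + 1 frees 2s + 1 + 2a in the exponent to pay for
-- the new construct.

open import Defs
open import Data.Nat using (ℕ; _≤_; _*_; _^_)
open import Data.Vec using ([])
open import Data.List using ([])
open import Data.Product using (Σ; _×_; proj₁; proj₂)
open import Data.Unit using (tt)
open import Relation.Binary.PropositionalEquality using (_≡_)
open import Relation.Binary.Definitions using (DecidableEquality)

open import Data.Nat using (zero; suc; _+_; _<_; z≤n; s≤s; NonZero; >-nonZero; +-rawMagma)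
open import Data.Nat.Properties
open import Data.Nat.ListAction using (sum)
open import Data.Nat.Tactic.RingSolver using (solve-∀)
open import Algebra.Definitions.RawMagma +-rawMagma using (_,_)
open import Algebra.Properties.CommutativeSemigroup *-commutativeSemigroup using (x∙yz≈y∙xz)
open import Data.Fin using (Fin)
import Data.Fin as F
import Data.Fin.Properties as FinP
open import Data.Vec using (Vec; _∷_; lookup; tabulate; zipWith; replicate)
import Data.Vec as V
open import Data.Vec.Properties
  using (tabulate∘lookup; tabulate-cong; lookup∘tabulate; lookup-map; lookup-zipWith; lookup-replicate; ≡-dec)
open import Data.List using (List; _∷_; length; map; concatMap; allFin)
open import Data.List.Properties using (length-map; length-++; length-tabulate; ∷-injectiveʳ)
open import Data.List.Membership.Propositional using (_∈_; find; lose)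
open import Data.List.Membership.Propositional.Properties using (∈-map⁺; ∈-concatMap⁺; ∈-allFin)
open import Data.List.Relation.Unary.Any using (here; there)
import Data.List.Relation.Unary.All as All
open import Data.List.Relation.Unary.Any.Properties using (any⁺; any⁻)
open import Data.List.Relation.Unary.All.Properties using (all⁺; all⁻)
open import Data.Bool using (Bool; true; false; not; _∧_)
open import Data.Bool.ListAction using (any; all)
open import Data.Bool.Properties using (T-≡; ∧-conicalˡ; ∧-conicalʳ) renaming (_≟_ to _≟ᵇ_)
open import Data.Product using (_,_)
open import Data.Unit using (⊤)
open import Data.Empty using (⊥-elim)
open import Function using (_∘_; id; case_of_)
open import Function.Bundles using (_⇔_; mk⇔; Equivalence)
open import Relation.Binary.PropositionalEquality using (refl; sym; trans; cong; cong₂; subst; module ≡-Reasoning)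
open import Relation.Nullary using (Dec; yes; no)
open import Relation.Nullary.Decidable using (⌊_⌋)

isYes≡true : ∀ {P : Set} (d : Dec P) → P → ⌊ d ⌋ ≡ true
isYes≡true (yes _) _ = refl
isYes≡true (no ¬p) p = ⊥-elim (¬p p)

isYes≡true⇒ : ∀ {P : Set} (d : Dec P) → ⌊ d ⌋ ≡ true → P
isYes≡true⇒ (yes p) _ = p

Bool-ext : ∀ {a b : Bool} → (a ≡ true → b ≡ true) → (b ≡ true → a ≡ true) → a ≡ b
Bool-ext {false} {false} _ _ = refl
Bool-ext {false} {true}  _ b⇒a = b⇒a refl
Bool-ext {true}  {_}     a⇒b _ = sym (a⇒b refl)

not-antitone : ∀ {a b : Bool} → (a ≡ true → b ≡ true) → not b ≡ true → not a ≡ true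
not-antitone {false} _   _ = refl
not-antitone {true}  a⇒b h = subst (λ c → not c ≡ true) (a⇒b refl) h

∧-monotone : ∀ {a b a′ b′ : Bool} → (a ≡ true → a′ ≡ true) → (b ≡ true → b′ ≡ true) →
             a ∧ b ≡ true → a′ ∧ b′ ≡ true
∧-monotone {a} {b} a⇒a′ b⇒b′ h = cong₂ _∧_ (a⇒a′ (∧-conicalˡ a b h)) (b⇒b′ (∧-conicalʳ a b h))

≡true-⇔-cong : ∀ {a b : Bool} {P : Set} → a ≡ b → (b ≡ true) ⇔ P → (a ≡ true) ⇔ P
≡true-⇔-cong refl b⇔P = b⇔P

Vec-ext : ∀ {A : Set} {n} {u w : Vec A n} → (∀ i → lookup u i ≡ lookup w i) → u ≡ w
Vec-ext {u = u} {w} h = trans (sym (tabulate∘lookup u)) (trans (tabulate-cong h) (tabulate∘lookup w))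

module _ {X : Set} (f : X → Bool) where

  any≡true⇒ : ∀ xs → any f xs ≡ true → Σ X λ x → x ∈ xs × f x ≡ true
  any≡true⇒ xs h with find (any⁻ f xs (Equivalence.from T-≡ h))
  ... | x , x∈xs , fx = x , x∈xs , Equivalence.to T-≡ fx

  any≡true⇐ : ∀ {xs x} → x ∈ xs → f x ≡ true → any f xs ≡ true
  any≡true⇐ x∈xs fx = Equivalence.to T-≡ (any⁺ f (lose x∈xs (Equivalence.from T-≡ fx)))

  all≡true⇒ : ∀ {xs x} → all f xs ≡ true → x ∈ xs → f x ≡ true
  all≡true⇒ h x∈xs = Equivalence.to T-≡ (All.lookup (all⁺ f _ (Equivalence.from T-≡ h)) x∈xs)

  all≡true⇐ : ∀ xs → (∀ {x} → x ∈ xs → f x ≡ true) → all f xs ≡ true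
  all≡true⇐ xs h = Equivalence.to T-≡ (all⁻ f (All.tabulate (Equivalence.from T-≡ ∘ h)))

successor-test⇔ : ∀ {Act S : Set} (_≟A_ : DecidableEquality Act) (_≟S_ : DecidableEquality S)
  (tr : List (S × Act × S)) (s : S) (a : Act) (P : S → Bool) →
  (any (λ t → ⌊ proj₁ t ≟S s ⌋ ∧ ⌊ proj₁ (proj₂ t) ≟A a ⌋ ∧ P (proj₂ (proj₂ t))) tr ≡ true) ⇔
  (Σ S λ s′ → (s , a , s′) ∈ tr × P s′ ≡ true)
successor-test⇔ {Act} {S} _≟A_ _≟S_ tr s a P = mk⇔ to from
  where
  test : S × Act × S → Bool
  test t = ⌊ proj₁ t ≟S s ⌋ ∧ ⌊ proj₁ (proj₂ t) ≟A a ⌋ ∧ P (proj₂ (proj₂ t))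
  to : any test tr ≡ true → Σ S λ s′ → (s , a , s′) ∈ tr × P s′ ≡ true
  to h with any≡true⇒ test tr h
  ... | (s₀ , a₀ , s′) , t∈tr , e
    with ∧-conicalˡ ⌊ s₀ ≟S s ⌋ _ e | ∧-conicalʳ ⌊ s₀ ≟S s ⌋ _ e
  ... | s₀≡s | rest
    with isYes≡true⇒ (s₀ ≟S s) s₀≡s | isYes≡true⇒ (a₀ ≟A a) (∧-conicalˡ ⌊ a₀ ≟A a ⌋ _ rest)
  ... | refl | refl = s′ , t∈tr , ∧-conicalʳ ⌊ a ≟A a ⌋ _ rest
  from : (Σ S λ s′ → (s , a , s′) ∈ tr × P s′ ≡ true) → any test tr ≡ true
  from (s′ , t∈tr , e) =
    any≡true⇐ test t∈tr (cong₂ _∧_ (isYes≡true (s ≟S s) refl) (cong₂ _∧_ (isYes≡true (a ≟A a) refl) e))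

module _ {X : Set} where

  sum-map-mono : ∀ (xs : List X) {f g : X → ℕ} → (∀ x → f x ≤ g x) → sum (map f xs) ≤ sum (map g xs)
  sum-map-mono []       f≤g = z≤n
  sum-map-mono (x ∷ xs) f≤g = +-mono-≤ (f≤g x) (sum-map-mono xs f≤g)

  sum-map-≤-* : ∀ (xs : List X) {f : X → ℕ} {b} → (∀ x → f x ≤ b) → sum (map f xs) ≤ length xs * b
  sum-map-≤-* []       f≤b = z≤n
  sum-map-≤-* (x ∷ xs) f≤b = +-mono-≤ (f≤b x) (sum-map-≤-* xs f≤b)

  sum-map-tight : ∀ (xs : List X) {f g : X → ℕ} → (∀ x → f x ≤ g x) →
                  sum (map g xs) ≤ sum (map f xs) → ∀ {x} → x ∈ xs → g x ≤ f x
  sum-map-tight (y ∷ xs) {f} {g} f≤g ≥ = tight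
    where
    gy≤fy : g y ≤ f y
    gy≤fy = +-cancelʳ-≤ _ _ _ (≤-trans (+-monoʳ-≤ (g y) (sum-map-mono xs f≤g)) ≥)
    rest : sum (map g xs) ≤ sum (map f xs)
    rest = +-cancelˡ-≤ _ _ _ (≤-trans (+-monoˡ-≤ (sum (map g xs)) (f≤g y)) ≥)
    tight : ∀ {x} → x ∈ y ∷ xs → g x ≤ f x
    tight (here refl) = gy≤fy
    tight (there x∈xs) = sum-map-tight xs f≤g rest x∈xs

indicator : Bool → ℕ
indicator false = 0
indicator true  = 1

indicator≤1 : ∀ b → indicator b ≤ 1
indicator≤1 false = z≤n
indicator≤1 true  = ≤-refl

indicator-mono : ∀ {a b} → (a ≡ true → b ≡ true) → indicator a ≤ indicator b
indicator-mono {false} _   = z≤n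
indicator-mono {true}  a⇒b rewrite a⇒b refl = ≤-refl

indicator-reflects : ∀ {a b} → indicator b ≤ indicator a → b ≡ true → a ≡ true
indicator-reflects {true}           _  _  = refl
indicator-reflects {false} {true}  () _
indicator-reflects {false} {false} _  ()

length-concatMap-const : ∀ {X Y : Set} (f : X → List Y) c (xs : List X) →
                         (∀ x → length (f x) ≡ c) → length (concatMap f xs) ≡ length xs * c
length-concatMap-const f c []       _ = refl
length-concatMap-const f c (x ∷ xs) h = trans (length-++ (f x)) (cong₂ _+_ (h x) (length-concatMap-const f c xs h))

length-all-vecs : ∀ {X : Set} k (xs : List X) → length (all-vecs k xs) ≡ length xs ^ k
length-all-vecs zero    xs = refl
length-all-vecs (suc k) xs =
  trans (length-concatMap-const _ _ xs (λ x → length-map (x ∷_) (all-vecs k xs)))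
        (cong (length xs *_) (length-all-vecs k xs))

all-vecs-complete : ∀ {X : Set} {xs : List X} → (∀ x → x ∈ xs) → ∀ k (v : Vec X k) → v ∈ all-vecs k xs
all-vecs-complete _        zero    []      = here refl
all-vecs-complete {xs = xs} complete (suc k) (x ∷ v) =
  ∈-concatMap⁺ (λ y → map (y ∷_) (all-vecs k xs)) (lose (complete x) (∈-map⁺ (x ∷_) (all-vecs-complete complete k v)))

length-allFin : ∀ n → length (allFin n) ≡ n
length-allFin n = length-tabulate id

Bool-complete : ∀ b → b ∈ false ∷ true ∷ []
Bool-complete false = here refl
Bool-complete true  = there (here refl)

module Correctness {Act : Set} (_≟A_ : DecidableEquality Act) (T₁ T₂ : LTS Act) where
  open Semantics _≟A_ T₁ T₂
  open LTS T₁ renaming (nSt to n₁; trans to tr₁)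
  open LTS T₂ renaming (nSt to n₂; trans to tr₂)

  ⊑-refl : ∀ {τ} (x : Val τ) → x ⊑ x
  ⊑-refl {[]}    _ _ _ h = h
  ⊑-refl {_ ∷ _} f T     = ⊑-refl (proj₁ f T)

  ⊑-trans : ∀ {τ} {x y z : Val τ} → x ⊑ y → y ⊑ z → x ⊑ z
  ⊑-trans {[]}    x⊑y y⊑z p q h = y⊑z p q (x⊑y p q h)
  ⊑-trans {_ ∷ _} x⊑y y⊑z T     = ⊑-trans (x⊑y T) (y⊑z T)

  ≈-refl : ∀ {τ} (x : Val τ) → x ≈ x
  ≈-refl x = ⊑-refl x , ⊑-refl x

  ≈-sym : ∀ {τ} {x y : Val τ} → x ≈ y → y ≈ x
  ≈-sym (x⊑y , y⊑x) = y⊑x , x⊑y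

  ≈-trans : ∀ {τ} {x y z : Val τ} → x ≈ y → y ≈ z → x ≈ z
  ≈-trans (x⊑y , y⊑x) (y⊑z , z⊑y) = ⊑-trans x⊑y y⊑z , ⊑-trans z⊑y y⊑x

  ⊆-antisym : ∀ {A B : PSet} → A ⊆ B → B ⊆ A → A ≡ B
  ⊆-antisym A⊆B B⊆A = Vec-ext λ p → Vec-ext λ q → Bool-ext (A⊆B p q) (B⊆A p q)

  mem-replicate : ∀ b p q → mem (replicate n₁ (replicate n₂ b)) p q ≡ b
  mem-replicate b p q = trans (cong (λ r → lookup r q) (lookup-replicate p _)) (lookup-replicate q b)

  mem-tabulate : ∀ (G : Fin n₁ → Fin n₂ → Bool) p q → mem (tabulate λ p → tabulate (G p)) p q ≡ G p q
  mem-tabulate G p q = trans (cong (λ r → lookup r q) (lookup∘tabulate _ p)) (lookup∘tabulate (G p) q)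

  mem-map-not : ∀ (A : PSet) p q → mem (V.map (V.map not) A) p q ≡ not (mem A p q)
  mem-map-not A p q = trans (cong (λ r → lookup r q) (lookup-map p _ A)) (lookup-map q not (lookup A p))

  mem-zipWith-∧ : ∀ (A B : PSet) p q → mem (zipWith (zipWith _∧_) A B) p q ≡ (mem A p q ∧ mem B p q)
  mem-zipWith-∧ A B p q =
    trans (cong (λ r → lookup r q) (lookup-zipWith _ p A B)) (lookup-zipWith _∧_ q (lookup A p) (lookup B p))

  mem-diaSet₁ : ∀ a u p q → (mem (diaSet a c₁ u) p q ≡ true) ⇔
                (Σ (Fin n₁) λ p′ → ((p , a , p′) ∈ tr₁) × mem u p′ q ≡ true)
  mem-diaSet₁ a u p q =
    ≡true-⇔-cong (mem-tabulate _ p q) (successor-test⇔ _≟A_ FinP._≟_ tr₁ p a (λ p′ → mem u p′ q))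

  mem-diaSet₂ : ∀ a u p q → (mem (diaSet a c₂ u) p q ≡ true) ⇔
                (Σ (Fin n₂) λ q′ → ((q , a , q′) ∈ tr₂) × mem u p q′ ≡ true)
  mem-diaSet₂ a u p q =
    ≡true-⇔-cong (mem-tabulate _ p q) (successor-test⇔ _≟A_ FinP._≟_ tr₂ q a (mem u p))

  ⊥ᵛ : ∀ τ → Val τ
  ⊥ᵛ-resp : ∀ v σ → Resp v σ (λ _ → ⊥ᵛ σ)
  ⊥ᵛ []      = emptySet
  ⊥ᵛ (v ∷ σ) = (λ _ → ⊥ᵛ σ) , ⊥ᵛ-resp v σ
  ⊥ᵛ-resp v+ σ _ _ _ = ⊑-refl (⊥ᵛ σ)
  ⊥ᵛ-resp v- σ _ _ _ = ⊑-refl (⊥ᵛ σ)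
  ⊥ᵛ-resp v± σ       = tt

  ⊥ᵛ-least : ∀ {τ} (x : Val τ) → ⊥ᵛ τ ⊑ x
  ⊥ᵛ-least {[]}    _ p q h with () ← trans (sym (mem-replicate false p q)) h
  ⊥ᵛ-least {_ ∷ _} f T = ⊥ᵛ-least (proj₁ f T)

  _⊑[_]_ : ∀ {τ} → Val τ → Variance → Val τ → Set
  x ⊑[ v+ ] y = x ⊑ y
  x ⊑[ v- ] y = y ⊑ x
  x ⊑[ v± ] y = x ≈ y

  ⊑[]-refl : ∀ {τ} v (x : Val τ) → x ⊑[ v ] x
  ⊑[]-refl v+ x = ⊑-refl x
  ⊑[]-refl v- x = ⊑-refl x
  ⊑[]-refl v± x = ≈-refl x

  ⊑[]-flip : ∀ {τ} v {x y : Val τ} → x ⊑[ v ] y → y ⊑[ flipV v ] x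
  ⊑[]-flip v+ x⊑y = x⊑y
  ⊑[]-flip v- y⊑x = y⊑x
  ⊑[]-flip v± x≈y = ≈-sym x≈y

  Env⊑ : ∀ {m} (Δ : Vec Ty m) → Vec Variance m → Env Δ → Env Δ → Set
  Env⊑ []      []      _       _        = ⊤
  Env⊑ (_ ∷ Δ) (v ∷ V) (x , ρ) (y , ρ′) = x ⊑[ v ] y × Env⊑ Δ V ρ ρ′

  Env⊑-refl : ∀ {m} (Δ : Vec Ty m) V ρ → Env⊑ Δ V ρ ρ
  Env⊑-refl []      []      _       = tt
  Env⊑-refl (_ ∷ Δ) (v ∷ V) (x , ρ) = ⊑[]-refl v x , Env⊑-refl Δ V ρ

  Env⊑-flip : ∀ {m} (Δ : Vec Ty m) V {ρ ρ′} → Env⊑ Δ V ρ ρ′ → Env⊑ Δ (flipAll V) ρ′ ρ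
  Env⊑-flip []      []      _            = tt
  Env⊑-flip (_ ∷ Δ) (v ∷ V) (x⊑y , ρ⊑ρ′) = ⊑[]-flip v x⊑y , Env⊑-flip Δ V ρ⊑ρ′

  Env⊑-lookup : ∀ {m} (Δ : Vec Ty m) V {ρ ρ′} (i : Fin m) → Env⊑ Δ V ρ ρ′ →
                Usable (lookup V i) → lookupEnv {Δ = Δ} ρ i ⊑ lookupEnv {Δ = Δ} ρ′ i
  Env⊑-lookup (_ ∷ Δ) (_ ∷ V) F.zero    (x⊑y , _) use+ = x⊑y
  Env⊑-lookup (_ ∷ Δ) (_ ∷ V) F.zero    (x≈y , _) use± = proj₁ x≈y
  Env⊑-lookup (_ ∷ Δ) (_ ∷ V) (F.suc i) (_ , ρ⊑ρ′) u   = Env⊑-lookup Δ V i ρ⊑ρ′ u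

  Env≈ : ∀ {m} (Δ : Vec Ty m) → Env Δ → Env Δ → Set
  Env≈ []      _       _        = ⊤
  Env≈ (_ ∷ Δ) (x , ρ) (y , ρ′) = x ≈ y × Env≈ Δ ρ ρ′

  Env≈-refl : ∀ {m} (Δ : Vec Ty m) ρ → Env≈ Δ ρ ρ
  Env≈-refl []      _       = tt
  Env≈-refl (_ ∷ Δ) (x , ρ) = ≈-refl x , Env≈-refl Δ ρ

  Env≈-sym : ∀ {m} (Δ : Vec Ty m) {ρ ρ′} → Env≈ Δ ρ ρ′ → Env≈ Δ ρ′ ρ
  Env≈-sym []      _           = tt
  Env≈-sym (_ ∷ Δ) (x≈y , ρ≈ρ′) = ≈-sym x≈y , Env≈-sym Δ ρ≈ρ′

  Env≈-lookup : ∀ {m} (Δ : Vec Ty m) {ρ ρ′} (i : Fin m) → Env≈ Δ ρ ρ′ →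
                lookupEnv {Δ = Δ} ρ i ≈ lookupEnv {Δ = Δ} ρ′ i
  Env≈-lookup (_ ∷ Δ) F.zero    (x≈y , _)  = x≈y
  Env≈-lookup (_ ∷ Δ) (F.suc i) (_ , ρ≈ρ′) = Env≈-lookup Δ i ρ≈ρ′

  fun-typing : ∀ {m} {Δ : Vec Ty m} {V} {Φ Ψ : Fm Act m} {σ} →
               Δ ∣ V ⊢ app Φ Ψ ∶ σ → Σ Variance λ v → Δ ∣ V ⊢ Φ ∶ (v ∷ σ)
  fun-typing (t-app+ d _)   = v+ , d
  fun-typing (t-app- d _)   = v- , d
  fun-typing (t-app± d _ _) = v± , d

  typing-unique : ∀ {m} {Δ : Vec Ty m} {V V′} {Φ : Fm Act m} {τ τ′} →
                  Δ ∣ V ⊢ Φ ∶ τ → Δ ∣ V′ ⊢ Φ ∶ τ′ → τ ≡ τ′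
  typing-unique t-tt           t-tt          = refl
  typing-unique (t-dia _)      (t-dia _)     = refl
  typing-unique (t-neg _)      (t-neg _)     = refl
  typing-unique (t-conj _ _)   (t-conj _ _)  = refl
  typing-unique (t-var i _)    (t-var .i _)  = refl
  typing-unique (t-lam d)      (t-lam d′)    = cong (_ ∷_) (typing-unique d d′)
  typing-unique (t-mu _)       (t-mu _)      = refl
  typing-unique (t-app+ d _)   e = ∷-injectiveʳ (typing-unique d (proj₂ (fun-typing e)))
  typing-unique (t-app- d _)   e = ∷-injectiveʳ (typing-unique d (proj₂ (fun-typing e)))
  typing-unique (t-app± d _ _) e = ∷-injectiveʳ (typing-unique d (proj₂ (fun-typing e)))

  Den-typing-irrelevant : ∀ {m} {Δ : Vec Ty m} {V V′ Φ τ} (d : Δ ∣ V ⊢ Φ ∶ τ) (d′ : Δ ∣ V′ ⊢ Φ ∶ τ) →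
                          ∀ {ρ w} →                           Den d ρ w → Den d′ ρ w
  Den-typing-irrelevant t-tt t-tt h = h
  Den-typing-irrelevant (t-dia {i = c₁} d) (t-dia d′) (u , du , e) = u , Den-typing-irrelevant d d′ du , e
  Den-typing-irrelevant (t-dia {i = c₂} d) (t-dia d′) (u , du , e) = u , Den-typing-irrelevant d d′ du , e
  Den-typing-irrelevant (t-neg d) (t-neg d′) (u , du , e) = u , Den-typing-irrelevant d d′ du , e
  Den-typing-irrelevant (t-conj d e) (t-conj d′ e′) (u , u′ , du , du′ , z) =
    u , u′ , Den-typing-irrelevant d d′ du , Den-typing-irrelevant e e′ du′ , z
  Den-typing-irrelevant (t-var i _) (t-var .i _) h = h
  Den-typing-irrelevant (t-lam d) (t-lam d′) h T = Den-typing-irrelevant d d′ (h T)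
  Den-typing-irrelevant (t-mu d) (t-mu d′) (fix , least) =
    Den-typing-irrelevant d d′ fix , λ f f′ df′ → least f f′ (Den-typing-irrelevant d′ d df′)
  Den-typing-irrelevant (t-app+ d e) (t-app+ d′ e′) (f , t , df , dt , z) =
    f , t , Den-typing-irrelevant d d′ df , Den-typing-irrelevant e e′ dt , z
  Den-typing-irrelevant (t-app- d e) (t-app- d′ e′) (f , t , df , dt , z) =
    f , t , Den-typing-irrelevant d d′ df , Den-typing-irrelevant e e′ dt , z
  Den-typing-irrelevant (t-app± d e _) (t-app± d′ e′ _) (f , t , df , dt , z) =
    f , t , Den-typing-irrelevant d d′ df , Den-typing-irrelevant e e′ dt , z
  Den-typing-irrelevant (t-app+ d _)   (t-app- d′ _)   _ with () ← typing-unique d d′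
  Den-typing-irrelevant (t-app+ d _)   (t-app± d′ _ _) _ with () ← typing-unique d d′
  Den-typing-irrelevant (t-app- d _)   (t-app+ d′ _)   _ with () ← typing-unique d d′
  Den-typing-irrelevant (t-app- d _)   (t-app± d′ _ _) _ with () ← typing-unique d d′
  Den-typing-irrelevant (t-app± d _ _) (t-app+ d′ _)   _ with () ← typing-unique d d′
  Den-typing-irrelevant (t-app± d _ _) (t-app- d′ _)   _ with () ← typing-unique d d′

  Den-cong-env : ∀ {m} {Δ : Vec Ty m} {V Φ τ} (d : Δ ∣ V ⊢ Φ ∶ τ) {ρ ρ′} → Env≈ Δ ρ ρ′ →
                 ∀ {w} → Den d ρ w → Den d ρ′ w
  Den-cong-env t-tt _ h = h
  Den-cong-env (t-dia {i = c₁} d) ρ≈ρ′ (u , du , e) = u , Den-cong-env d ρ≈ρ′ du , e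
  Den-cong-env (t-dia {i = c₂} d) ρ≈ρ′ (u , du , e) = u , Den-cong-env d ρ≈ρ′ du , e
  Den-cong-env (t-neg d) ρ≈ρ′ (u , du , e) = u , Den-cong-env d ρ≈ρ′ du , e
  Den-cong-env (t-conj d e) ρ≈ρ′ (u , u′ , du , du′ , z) =
    u , u′ , Den-cong-env d ρ≈ρ′ du , Den-cong-env e ρ≈ρ′ du′ , z
  Den-cong-env {Δ = Δ} (t-var i _) ρ≈ρ′ h = ≈-trans h (Env≈-lookup Δ i ρ≈ρ′)
  Den-cong-env (t-lam d) ρ≈ρ′ h T = Den-cong-env d (≈-refl T , ρ≈ρ′) (h T)
  Den-cong-env {Δ = Δ} (t-mu d) ρ≈ρ′ {w} (fix , least) =
    Den-cong-env d (≈-refl w , ρ≈ρ′) fix ,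
    λ f f′ df′ → least f f′ (Den-cong-env d (≈-refl f , Env≈-sym Δ ρ≈ρ′) df′)
  Den-cong-env (t-app+ d e) ρ≈ρ′ (f , t , df , dt , z) = f , t , Den-cong-env d ρ≈ρ′ df , Den-cong-env e ρ≈ρ′ dt , z
  Den-cong-env (t-app- d e) ρ≈ρ′ (f , t , df , dt , z) = f , t , Den-cong-env d ρ≈ρ′ df , Den-cong-env e ρ≈ρ′ dt , z
  Den-cong-env (t-app± d e _) ρ≈ρ′ (f , t , df , dt , z) = f , t , Den-cong-env d ρ≈ρ′ df , Den-cong-env e ρ≈ρ′ dt , z

  ≈⇒≡ : ∀ {A B : PSet} → _≈_ {[]} A B → A ≡ B
  ≈⇒≡ (A⊆B , B⊆A) = ⊆-antisym A⊆B B⊆A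

  Den-cong-val : ∀ {m} {Δ : Vec Ty m} {V Φ τ} (d : Δ ∣ V ⊢ Φ ∶ τ) {ρ w w′} →
                 Den d ρ w → w ≈ w′ → Den d ρ w′
  Den-cong-val d@t-tt        {ρ} {w} {w′} h w≈w′ = subst (Den d ρ) (≈⇒≡ {w} {w′} w≈w′) h
  Den-cong-val d@(t-dia _)    {ρ} {w} {w′} h w≈w′ = subst (Den d ρ) (≈⇒≡ {w} {w′} w≈w′) h
  Den-cong-val d@(t-neg _)    {ρ} {w} {w′} h w≈w′ = subst (Den d ρ) (≈⇒≡ {w} {w′} w≈w′) h
  Den-cong-val d@(t-conj _ _) {ρ} {w} {w′} h w≈w′ = subst (Den d ρ) (≈⇒≡ {w} {w′} w≈w′) h
  Den-cong-val (t-var i _) h w≈w′ = ≈-trans (≈-sym w≈w′) h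
  Den-cong-val (t-lam d) h w≈w′ T = Den-cong-val d (h T) (proj₁ w≈w′ T , proj₂ w≈w′ T)
  Den-cong-val {Δ = Δ} (t-mu d) {ρ} (fix , least) w≈w′ =
    Den-cong-val d (Den-cong-env d (w≈w′ , Env≈-refl Δ ρ) fix) w≈w′ ,
    λ f f′ df′ f′⊑f → ⊑-trans (proj₂ w≈w′) (least f f′ df′ f′⊑f)
  Den-cong-val (t-app+ _ _)   (f , t , df , dt , z) w≈w′ = f , t , df , dt , ≈-trans z w≈w′
  Den-cong-val (t-app- _ _)   (f , t , df , dt , z) w≈w′ = f , t , df , dt , ≈-trans z w≈w′
  Den-cong-val (t-app± _ _ _) (f , t , df , dt , z) w≈w′ = f , t , df , dt , ≈-trans z w≈w′

  Represents : (τ : Ty) → Sem → Val τ → Set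
  Represents []      s A = s ≡ set A
  Represents (_ ∷ σ) s f = Σ (PSet → Sem) λ g → s ≡ fun g × (∀ T → Represents σ (g T) (proj₁ f T))

  RepresentsEnv : ∀ {m} (Δ : Vec Ty m) → Vec Sem m → Env Δ → Set
  RepresentsEnv []      []       _       = ⊤
  RepresentsEnv (τ ∷ Δ) (s ∷ ss) (x , ρ) = Represents τ s x × RepresentsEnv Δ ss ρ

  RepresentsEnv-lookup : ∀ {m} (Δ : Vec Ty m) {ss ρ} (i : Fin m) → RepresentsEnv Δ ss ρ →
                         Represents (lookup Δ i) (lookup ss i) (lookupEnv {Δ = Δ} ρ i)
  RepresentsEnv-lookup (_ ∷ Δ) {_ ∷ _} F.zero    (rep , _) = rep
  RepresentsEnv-lookup (_ ∷ Δ) {_ ∷ _} (F.suc i) (_ , reps) = RepresentsEnv-lookup Δ i reps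

  tabulateVal : ∀ τ → Val τ → Sem
  tabulateVal []      A = set A
  tabulateVal (_ ∷ σ) f = fun (λ T → tabulateVal σ (proj₁ f T))

  tabulateVal-represents : ∀ τ x → Represents τ (tabulateVal τ x) x
  tabulateVal-represents []      _ = refl
  tabulateVal-represents (_ ∷ σ) f = _ , refl , λ T → tabulateVal-represents σ (proj₁ f T)

  tabulateEnv : ∀ {m} (Δ : Vec Ty m) → Env Δ → Vec Sem m
  tabulateEnv []      _       = []
  tabulateEnv (τ ∷ Δ) (x , ρ) = tabulateVal τ x ∷ tabulateEnv Δ ρ

  tabulateEnv-represents : ∀ {m} (Δ : Vec Ty m) ρ → RepresentsEnv Δ (tabulateEnv Δ ρ) ρ
  tabulateEnv-represents []      _       = tt
  tabulateEnv-represents (τ ∷ Δ) (x , ρ) = tabulateVal-represents τ x , tabulateEnv-represents Δ ρ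

  botSem-represents : ∀ τ → Represents τ (botSem (length τ)) (⊥ᵛ τ)
  botSem-represents []      = refl
  botSem-represents (_ ∷ σ) = _ , refl , λ _ → botSem-represents σ

  applySem-represents : ∀ {σ} {s s′ : Sem} {g : PSet → Sem} {T : PSet} {y : Val σ} →
                        s ≡ fun g → s′ ≡ set T → Represents σ (g T) y → Represents σ (applySem s s′) y
  applySem-represents refl refl rep = rep

  allSets-complete : ∀ (A : PSet) → A ∈ allSets
  allSets-complete = all-vecs-complete (all-vecs-complete Bool-complete n₂) n₁

  length-allSets : length allSets ≡ 2 ^ N
  length-allSets = begin
    length allSets                                   ≡⟨ length-all-vecs n₁ _ ⟩
    length (all-vecs n₂ (false ∷ true ∷ [])) ^ n₁    ≡⟨ cong (_^ n₁) (length-all-vecs n₂ _) ⟩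
    (2 ^ n₂) ^ n₁                                    ≡⟨ ^-*-assoc 2 n₂ n₁ ⟩
    2 ^ (n₂ * n₁)                                    ≡⟨ cong (2 ^_) (*-comm n₂ n₁) ⟩
    2 ^ N                                            ∎
    where open ≡-Reasoning

  card : PSet → ℕ
  card A = sum (map (λ p → sum (map (λ q → indicator (mem A p q)) (allFin n₂))) (allFin n₁))

  card≤N : ∀ A → card A ≤ N
  card≤N A = begin
    card A                                          ≤⟨ sum-map-≤-* (allFin n₁) row≤n₂ ⟩
    length (allFin n₁) * (length (allFin n₂) * 1)   ≡⟨ cong₂ _*_ (length-allFin n₁) (cong (_* 1) (length-allFin n₂)) ⟩
    n₁ * (n₂ * 1)                                   ≡⟨ cong (n₁ *_) (*-identityʳ n₂) ⟩
    N                                               ∎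
    where
    open ≤-Reasoning
    row≤n₂ : ∀ p → sum (map (λ q → indicator (mem A p q)) (allFin n₂)) ≤ length (allFin n₂) * 1
    row≤n₂ p = sum-map-≤-* (allFin n₂) (λ q → indicator≤1 (mem A p q))

  card-mono : ∀ A B → A ⊆ B → card A ≤ card B
  card-mono A B A⊆B = sum-map-mono (allFin n₁) λ p → sum-map-mono (allFin n₂) λ q → indicator-mono (A⊆B p q)

  card-tight : ∀ A B → A ⊆ B → card B ≤ card A → B ⊆ A
  card-tight A B A⊆B B≤A p q = indicator-reflects
    (sum-map-tight (allFin n₂) (λ q → indicator-mono (A⊆B p q))
      (sum-map-tight (allFin n₁) row-mono B≤A (∈-allFin p)) (∈-allFin q))
    where
    row : PSet → Fin n₁ → ℕ
    row C p = sum (map (λ q → indicator (mem C p q)) (allFin n₂))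
    row-mono : ∀ p → row A p ≤ row B p
    row-mono p = sum-map-mono (allFin n₂) λ q → indicator-mono (A⊆B p q)

  weight : ℕ → Sem → ℕ
  weight zero    (set A) = card A
  weight (suc k) (fun g) = sum (map (λ T → weight k (g T)) allSets)
  weight _       _       = 0

  weight≤tableSize : ∀ τ {s} {x : Val τ} → Represents τ s x → weight (length τ) s ≤ tableSize (length τ)
  weight≤tableSize []      {x = A} refl = ≤-trans (card≤N A) (≤-reflexive (sym (*-identityʳ N)))
  weight≤tableSize (_ ∷ σ) {x = f} (g , refl , rep) = begin
    sum (map (λ T → weight (length σ) (g T)) allSets) ≤⟨ sum-map-≤-* allSets (λ T → weight≤tableSize σ (rep T)) ⟩
    length allSets * (N * length allSets ^ length σ)  ≡⟨ x∙yz≈y∙xz (length allSets) N _ ⟩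
    N * (length allSets * length allSets ^ length σ)  ∎
    where open ≤-Reasoning

  weight-mono : ∀ τ {s s′} {x y : Val τ} → Represents τ s x → Represents τ s′ y → x ⊑ y →
                weight (length τ) s ≤ weight (length τ) s′
  weight-mono [] {x = A} {B} refl refl A⊆B = card-mono A B A⊆B
  weight-mono (_ ∷ σ) (g , refl , rep) (g′ , refl , rep′) x⊑y =
    sum-map-mono allSets λ T → weight-mono σ (rep T) (rep′ T) (x⊑y T)

  weight-tight : ∀ τ {s s′} {x y : Val τ} → Represents τ s x → Represents τ s′ y → x ⊑ y →
                 weight (length τ) s′ ≤ weight (length τ) s → eqSem (length τ) s′ s ≡ true
  weight-tight [] {x = A} {B} refl refl A⊆B B≤A =
    isYes≡true (≡-dec (≡-dec _≟ᵇ_) B A) (⊆-antisym {B} {A} (card-tight A B A⊆B B≤A) A⊆B)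
  weight-tight (_ ∷ σ) (g , refl , rep) (g′ , refl , rep′) x⊑y ≥ =
    all≡true⇐ _ allSets λ {T} T∈ → weight-tight σ (rep T) (rep′ T) (x⊑y T)
      (sum-map-tight allSets (λ T → weight-mono σ (rep T) (rep′ T) (x⊑y T)) ≥ T∈)

  weight-strict : ∀ τ {s s′} {x y : Val τ} → Represents τ s x → Represents τ s′ y → x ⊑ y →
                  eqSem (length τ) s′ s ≡ false → weight (length τ) s < weight (length τ) s′
  weight-strict τ rep rep′ x⊑y ≢ = ≰⇒> λ ≥ → case trans (sym ≢) (weight-tight τ rep rep′ x⊑y ≥) of λ ()

  eqSem-sound : ∀ τ {s s′} {x y : Val τ} → Represents τ s x → Represents τ s′ y →
                eqSem (length τ) s s′ ≡ true → x ≈ y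
  eqSem-sound [] {x = A} {B} refl refl eq with isYes≡true⇒ (≡-dec (≡-dec _≟ᵇ_) A B) eq
  ... | refl = ≈-refl A
  eqSem-sound (_ ∷ σ) {x = f} {f′} (g , refl , rep) (g′ , refl , rep′) eq =
    (λ T → proj₁ (entries T)) , (λ T → proj₂ (entries T))
    where
    entries : ∀ T → proj₁ f T ≈ proj₁ f′ T
    entries T = eqSem-sound σ (rep T) (rep′ T) (all≡true⇒ _ eq (allSets-complete T))

  iterate-stabilises : ∀ k (step : Sem → Sem × ℕ) (μ : Sem → ℕ) (bound : ℕ) (Inv Out : Sem → Set) →
    (∀ s → Inv s → μ s ≤ bound) →
    (∀ s → Inv s → eqSem k (proj₁ (step s)) s ≡ true → Out s) →
    (∀ s → Inv s → eqSem k (proj₁ (step s)) s ≡ false → Inv (proj₁ (step s)) × μ s < μ (proj₁ (step s))) →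
    ∀ fuel s → Inv s → bound < μ s + fuel → Out (proj₁ (iterate k step fuel s))
  iterate-stabilises k step μ bound Inv Out bounded stable grows = go
    where
    go : ∀ fuel s → Inv s → bound < μ s + fuel → Out (proj₁ (iterate k step fuel s))
    go zero s inv bound<μ = ⊥-elim (<⇒≱ bound<μ (≤-trans (≤-reflexive (+-identityʳ (μ s))) (bounded s inv)))
    go (suc fuel) s inv bound<μ with eqSem k (proj₁ (step s)) s in eq
    ... | true  = stable s inv eq
    ... | false with grows s inv eq
    ... | inv′ , μs<μs′ = go fuel (proj₁ (step s)) inv′
      (<-≤-trans bound<μ (≤-trans (≤-reflexive (+-suc (μ s) fuel)) (+-monoˡ-≤ fuel μs<μs′)))

  Resp-intro : ∀ v σ (f : PSet → Val σ) → (∀ T T′ → _⊑[_]_ {[]} T v T′ → f T ⊑ f T′) → Resp v σ f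
  Resp-intro v+ σ f mono T T′ T⊆T′ = mono T T′ T⊆T′
  Resp-intro v- σ f mono T T′ T⊆T′ = mono T′ T T⊆T′
  Resp-intro v± σ f mono = tt

  -- Soundness of MC and monotonicity of the semantics are proved together:
  -- the semantics of a λ needs monotonicity of its body to be a value of the
  -- right variance, and comparing two least fixpoints needs the existence of
  -- the semantics of the body at one of them.
  MC-sound : ∀ {m} {Δ : Vec Ty m} {V} {Φ : Fm Act m} {τ} (d : Δ ∣ V ⊢ Φ ∶ τ) (ss : Vec Sem m) (ρ : Env Δ) →
             RepresentsEnv Δ ss ρ → Σ (Val τ) λ w → Den d ρ w × Represents τ (proj₁ (MC Φ ss)) w
  Den-monotone : ∀ {m} {Δ : Vec Ty m} {V} {Φ : Fm Act m} {τ} (d : Δ ∣ V ⊢ Φ ∶ τ) (ρ ρ′ : Env Δ) →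
                 Env⊑ Δ V ρ ρ′ → ∀ {w w′} → Den d ρ w → Den d ρ′ w′ → w ⊑ w′

  MC-sound t-tt ss ρ reps = topSet , mem-replicate true , refl
  MC-sound (t-dia {a = a} {i = c₁} d) ss ρ reps with MC-sound d ss ρ reps
  ... | u , du , rep = diaSet a c₁ u , (u , du , mem-diaSet₁ a u) , cong (set ∘ diaSet a c₁ ∘ asSet) rep
  MC-sound (t-dia {a = a} {i = c₂} d) ss ρ reps with MC-sound d ss ρ reps
  ... | u , du , rep = diaSet a c₂ u , (u , du , mem-diaSet₂ a u) , cong (set ∘ diaSet a c₂ ∘ asSet) rep
  MC-sound (t-neg d) ss ρ reps with MC-sound d ss ρ reps
  ... | u , du , rep = V.map (V.map not) u , (u , du , mem-map-not u) , cong (set ∘ V.map (V.map not) ∘ asSet) rep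
  MC-sound (t-conj d e) ss ρ reps with MC-sound d ss ρ reps | MC-sound e ss ρ reps
  ... | u , du , rep | u′ , du′ , rep′ =
    zipWith (zipWith _∧_) u u′ , (u , u′ , du , du′ , mem-zipWith-∧ u u′) ,
    cong₂ (λ s s′ → set (zipWith (zipWith _∧_) (asSet s) (asSet s′))) rep rep′
  MC-sound {Δ = Δ} (t-var i _) ss ρ reps = lookupEnv {Δ = Δ} ρ i , ≈-refl _ , RepresentsEnv-lookup Δ i reps
  MC-sound {Δ = Δ} {V} (t-lam {v = v} {σ} {Φ} d) ss ρ reps =
    ((λ T → proj₁ (body T)) , Resp-intro v σ _ body-mono) ,
    (λ T → proj₁ (proj₂ (body T))) , _ , refl , (λ T → proj₂ (proj₂ (body T)))
    where
    body : (T : PSet) → Σ (Val σ) λ w → Den d (T , ρ) w × Represents σ (proj₁ (MC Φ (set T ∷ ss))) w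
    body T = MC-sound d (set T ∷ ss) (T , ρ) (refl , reps)
    body-mono : ∀ T T′ → _⊑[_]_ {[]} T v T′ → proj₁ (body T) ⊑ proj₁ (body T′)
    body-mono T T′ T⊑T′ =
      Den-monotone d (T , ρ) (T′ , ρ) (T⊑T′ , Env⊑-refl Δ V ρ) (proj₁ (proj₂ (body T))) (proj₁ (proj₂ (body T′)))
  MC-sound {Δ = Δ} {V} (t-mu {τ = τ} {Φ} d) ss ρ reps =
    iterate-stabilises a (λ s → MC Φ (s ∷ ss)) (weight a) (tableSize a) Iterate Least
      (λ _ (_ , rep , _) → weight≤tableSize τ rep) stable grows
      (suc (tableSize a)) (botSem a) (⊥ᵛ τ , botSem-represents τ , (λ y _ → ⊥ᵛ-least y) , (λ f _ _ _ → ⊥ᵛ-least f))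
      (m≤n+m (suc (tableSize a)) (weight a (botSem a)))
    where
    a = length τ
    step : ∀ s x → Represents τ s x → Σ (Val τ) λ y → Den d (x , ρ) y × Represents τ (proj₁ (MC Φ (s ∷ ss))) y
    step s x rep = MC-sound d (s ∷ ss) (x , ρ) (rep , reps)
    PostFixed BelowPreFixed : Val τ → Set
    PostFixed x = ∀ y → Den d (x , ρ) y → x ⊑ y
    BelowPreFixed x = ∀ f f′ → Den d (f , ρ) f′ → f′ ⊑ f → x ⊑ f
    Iterate Least : Sem → Set
    Iterate s = Σ (Val τ) λ x → Represents τ s x × PostFixed x × BelowPreFixed x
    Least s = Σ (Val τ) λ w → Den (t-mu d) ρ w × Represents τ s w
    stable : ∀ s → Iterate s → eqSem a (proj₁ (MC Φ (s ∷ ss))) s ≡ true → Least s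
    stable s (x , rep , _ , below) eq with step s x rep
    ... | y , dy , rep′ = x , (Den-cong-val d dy (eqSem-sound τ rep′ rep eq) , below) , rep
    grows : ∀ s → Iterate s → eqSem a (proj₁ (MC Φ (s ∷ ss))) s ≡ false →
            Iterate (proj₁ (MC Φ (s ∷ ss))) × weight a s < weight a (proj₁ (MC Φ (s ∷ ss)))
    grows s (x , rep , post , below) neq with step s x rep
    ... | y , dy , rep′ = (y , rep′ , post′ , below′) , weight-strict τ rep rep′ x⊑y neq
      where
      x⊑y : x ⊑ y
      x⊑y = post y dy
      post′ : PostFixed y
      post′ z dz = Den-monotone d (x , ρ) (y , ρ) (x⊑y , Env⊑-refl Δ V ρ) dy dz
      below′ : BelowPreFixed y
      below′ f f′ df′ f′⊑f =
        ⊑-trans (Den-monotone d (x , ρ) (f , ρ) (below f f′ df′ f′⊑f , Env⊑-refl Δ V ρ) dy df′) f′⊑f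
  MC-sound (t-app+ d e) ss ρ reps with MC-sound d ss ρ reps | MC-sound e ss ρ reps
  ... | f , df , (g , eg , rep) | T , dT , eT = proj₁ f T , (f , T , df , dT , ≈-refl _) , applySem-represents eg eT (rep T)
  MC-sound (t-app- d e) ss ρ reps with MC-sound d ss ρ reps | MC-sound e ss ρ reps
  ... | f , df , (g , eg , rep) | T , dT , eT = proj₁ f T , (f , T , df , dT , ≈-refl _) , applySem-represents eg eT (rep T)
  MC-sound (t-app± d e _) ss ρ reps with MC-sound d ss ρ reps | MC-sound e ss ρ reps
  ... | f , df , (g , eg , rep) | T , dT , eT = proj₁ f T , (f , T , df , dT , ≈-refl _) , applySem-represents eg eT (rep T)

  Den-monotone t-tt ρ ρ′ _ _ top′ p q _ = top′ p q
  Den-monotone (t-dia {i = c₁} d) ρ ρ′ ρ⊑ρ′ (u , du , e) (u′ , du′ , e′) p q m with Equivalence.to (e p q) m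
  ... | p′ , t∈ , m′ = Equivalence.from (e′ p q) (p′ , t∈ , Den-monotone d ρ ρ′ ρ⊑ρ′ du du′ p′ q m′)
  Den-monotone (t-dia {i = c₂} d) ρ ρ′ ρ⊑ρ′ (u , du , e) (u′ , du′ , e′) p q m with Equivalence.to (e p q) m
  ... | q′ , t∈ , m′ = Equivalence.from (e′ p q) (q′ , t∈ , Den-monotone d ρ ρ′ ρ⊑ρ′ du du′ p q′ m′)
  Den-monotone {Δ = Δ} {V} (t-neg d) ρ ρ′ ρ⊑ρ′ (u , du , e) (u′ , du′ , e′) p q m =
    trans (e′ p q) (not-antitone (Den-monotone d ρ′ ρ (Env⊑-flip Δ V ρ⊑ρ′) du′ du p q) (trans (sym (e p q)) m))
  Den-monotone (t-conj d d′) ρ ρ′ ρ⊑ρ′ (u , v , du , dv , e) (u′ , v′ , du′ , dv′ , e′) p q m =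
    trans (e′ p q) (∧-monotone (Den-monotone d ρ ρ′ ρ⊑ρ′ du du′ p q)
                               (Den-monotone d′ ρ ρ′ ρ⊑ρ′ dv dv′ p q)
                               (trans (sym (e p q)) m))
  Den-monotone {Δ = Δ} {V} (t-var i usable) ρ ρ′ ρ⊑ρ′ w≈ w′≈ =
    ⊑-trans (proj₁ w≈) (⊑-trans (Env⊑-lookup Δ V i ρ⊑ρ′ usable) (proj₂ w′≈))
  Den-monotone (t-lam {v = v} d) ρ ρ′ ρ⊑ρ′ dw dw′ T =
    Den-monotone d (T , ρ) (T , ρ′) (⊑[]-refl v T , ρ⊑ρ′) (dw T) (dw′ T)
  Den-monotone {Δ = Δ} (t-mu {τ = τ} d) ρ ρ′ ρ⊑ρ′ {w} {w′} (_ , least) (fix′ , _)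
    with MC-sound d (tabulateVal τ w′ ∷ tabulateEnv Δ ρ) (w′ , ρ) (tabulateVal-represents τ w′ , tabulateEnv-represents Δ ρ)
  ... | y , dy , _ = least w′ y dy (Den-monotone d (w′ , ρ) (w′ , ρ′) (⊑-refl w′ , ρ⊑ρ′) dy fix′)
  Den-monotone (t-app+ d e) ρ ρ′ ρ⊑ρ′ (f , t , df , dt , z) (f′ , t′ , df′ , dt′ , z′) =
    ⊑-trans (proj₂ z) (⊑-trans (proj₂ f t t′ (Den-monotone e ρ ρ′ ρ⊑ρ′ dt dt′))
      (⊑-trans (Den-monotone d ρ ρ′ ρ⊑ρ′ df df′ t′) (proj₁ z′)))
  Den-monotone {Δ = Δ} {V} (t-app- d e) ρ ρ′ ρ⊑ρ′ (f , t , df , dt , z) (f′ , t′ , df′ , dt′ , z′) =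
    ⊑-trans (proj₂ z) (⊑-trans (proj₂ f t′ t (Den-monotone e ρ′ ρ (Env⊑-flip Δ V ρ⊑ρ′) dt′ dt))
      (⊑-trans (Den-monotone d ρ ρ′ ρ⊑ρ′ df df′ t′) (proj₁ z′)))
  Den-monotone {Δ = Δ} {V} (t-app± d e e±) ρ ρ′ ρ⊑ρ′ (f , t , df , dt , z) (f′ , t′ , df′ , dt′ , z′) =
    ⊑-trans (proj₂ z)
      (⊑-trans (subst (λ c → proj₁ f t ⊑ proj₁ f′ c) t≡t′ (Den-monotone d ρ ρ′ ρ⊑ρ′ df df′ t)) (proj₁ z′))
    where
    -- The argument of a ±-function is used both positively and negatively.
    t≡t′ : t ≡ t′
    t≡t′ = ⊆-antisym (Den-monotone e ρ ρ′ ρ⊑ρ′ dt dt′)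
             (Den-monotone e± ρ′ ρ (Env⊑-flip Δ V ρ⊑ρ′) (Den-typing-irrelevant e e± dt′) (Den-typing-irrelevant e e± dt))

  MC-correct : ∀ {Φ : Fm Act 0} (d : [] ∣ [] ⊢ Φ ∶ []) → Σ PSet λ S → proj₁ (MC Φ []) ≡ set S × Den d tt S
  MC-correct d with MC-sound d [] tt tt
  ... | S , den , rep = S , rep , den

costExponent : ℕ → ℕ → ℕ
costExponent s a = s * s + 2 * s * a

costExponent-monoʳ : ∀ s a → costExponent s a ≤ costExponent s (suc a)
costExponent-monoʳ s a = +-monoʳ-≤ (s * s) (*-monoʳ-≤ (2 * s) (n≤1+n a))

costExponent-closed : ∀ s → costExponent s 0 ≡ s ^ 2
costExponent-closed s = identity s
  where
  identity : ∀ s → s * s + 2 * s * 0 ≡ s * (s * 1)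
  identity = solve-∀

costExponent-unary : ∀ s → 1 ≤ s → suc (costExponent s 0 + 1) ≤ costExponent (suc s) 0
costExponent-unary (suc r) _ = ≤″⇒≤ (1 + 2 * r , identity r)
  where
  identity : ∀ r → suc ((1 + r) * (1 + r) + 2 * (1 + r) * 0 + 1) + (1 + 2 * r) ≡ (2 + r) * (2 + r) + 2 * (2 + r) * 0
  identity = solve-∀

costExponent-binary : ∀ s₁ s₂ l → 1 ≤ s₁ → 1 ≤ s₂ →
  suc (suc (costExponent s₁ (suc l) + costExponent s₂ 0) + 0) ≤ costExponent (suc (s₁ + s₂)) l
costExponent-binary (suc a) (suc b) l _ _ = ≤″⇒≤ (3 + 2 * a + 4 * b + 2 * a * b + 4 * l + 2 * b * l , identity a b l)
  where
  identity : ∀ a b l →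
    suc (suc (((1 + a) * (1 + a) + 2 * (1 + a) * (1 + l)) + ((1 + b) * (1 + b) + 2 * (1 + b) * 0)) + 0)
      + (3 + 2 * a + 4 * b + 2 * a * b + 4 * l + 2 * b * l)
    ≡ (1 + ((1 + a) + (1 + b))) * (1 + ((1 + a) + (1 + b))) + 2 * (1 + ((1 + a) + (1 + b))) * l
  identity = solve-∀

costExponent-lam : ∀ s l → 1 ≤ s → suc (costExponent s l) ≤ costExponent (suc s) (suc l)
costExponent-lam (suc r) l _ = ≤″⇒≤ (6 + 4 * r + 2 * l , identity r l)
  where
  identity : ∀ r l → suc ((1 + r) * (1 + r) + 2 * (1 + r) * l) + (6 + 4 * r + 2 * l)
                     ≡ (2 + r) * (2 + r) + 2 * (2 + r) * (1 + l)
  identity = solve-∀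

costExponent-mu : ∀ s a → 1 ≤ s → suc (suc a) + suc (costExponent s a + a) ≤ costExponent (suc s) a
costExponent-mu (suc r) a _ = ≤″⇒≤ (2 * r , identity r a)
  where
  identity : ∀ r a → (2 + a) + suc (((1 + r) * (1 + r) + 2 * (1 + r) * a) + a) + 2 * r
                     ≡ (2 + r) * (2 + r) + 2 * (2 + r) * a
  identity = solve-∀

n<2^n : ∀ n → n < 2 ^ n
n<2^n zero    = s≤s z≤n
n<2^n (suc m) = ≤-trans (+-mono-≤ (m^n>0 2 m) (n<2^n m)) (≤-reflexive (cong (2 ^ m +_) (sym (+-identityʳ (2 ^ m)))))

module PowerBounds (u Q : ℕ) (2≤Q : 2 ≤ Q) where
  instance
    Q-nonZero : NonZero Q
    Q-nonZero = >-nonZero (≤-trans (s≤s z≤n) 2≤Q)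

  ^-double : ∀ x → Q ^ x + Q ^ x ≤ Q ^ suc x
  ^-double x = ≤-trans (≤-reflexive (cong (Q ^ x +_) (sym (+-identityʳ (Q ^ x))))) (*-monoˡ-≤ (Q ^ x) 2≤Q)

  raise : ∀ {a} x {y} → a ≤ u * Q ^ x → x ≤ y → a ≤ u * Q ^ y
  raise x a≤ x≤y = ≤-trans a≤ (*-monoʳ-≤ u (^-monoʳ-≤ Q x≤y))

  ≤u⇒≤u*Q^ : ∀ {a} x → a ≤ u → a ≤ u * Q ^ x
  ≤u⇒≤u*Q^ x a≤u = raise 0 {x} (≤-trans a≤u (≤-reflexive (sym (*-identityʳ u)))) z≤n

  +-bound : ∀ {a b} x y → a ≤ u * Q ^ x → b ≤ u * Q ^ y → a + b ≤ u * Q ^ suc (x + y)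
  +-bound {a} {b} x y a≤ b≤ = begin
    a + b                               ≤⟨ +-mono-≤ (raise x a≤ (m≤m+n x y)) (raise y b≤ (m≤n+m y x)) ⟩
    u * Q ^ (x + y) + u * Q ^ (x + y)   ≡⟨ *-distribˡ-+ u (Q ^ (x + y)) (Q ^ (x + y)) ⟨
    u * (Q ^ (x + y) + Q ^ (x + y))     ≤⟨ *-monoʳ-≤ u (^-double (x + y)) ⟩
    u * Q ^ suc (x + y)                 ∎
    where open ≤-Reasoning

1≤size : ∀ {Act m} (Φ : Fm Act m) → 1 ≤ size Φ
1≤size tt          = s≤s z≤n
1≤size (dia _ _ _) = s≤s z≤n
1≤size (neg _)     = s≤s z≤n
1≤size (conj _ _)  = s≤s z≤n
1≤size (var _)     = s≤s z≤n
1≤size (lam _ _)   = s≤s z≤n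
1≤size (mu _ _)    = s≤s z≤n
1≤size (app _ _)   = s≤s z≤n

module Cost {Act : Set} (_≟A_ : DecidableEquality Act) (T₁ T₂ : LTS Act) (n : ℕ) where
  open Semantics _≟A_ T₁ T₂
  open Correctness _≟A_ T₁ T₂ using (length-allSets)
  open LTS T₁ renaming (nSt to n₁; trans to tr₁)
  open LTS T₂ renaming (nSt to n₂; trans to tr₂)

  costBound : ∀ {m} → Fm Act m → ℕ
  costBound tt          = N
  costBound (dia _ _ Φ) = costBound Φ + N * suc n
  costBound (neg Φ)     = costBound Φ + N
  costBound (conj Φ Ψ)  = costBound Φ + costBound Ψ + N
  costBound (var _)     = 1
  costBound (lam _ Φ)   = length allSets * costBound Φ
  costBound (mu τ Φ)    = suc (tableSize (length τ)) * (costBound Φ + tableSize (length τ))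
  costBound (app Φ Ψ)   = costBound Φ + costBound Ψ + N

  iterate-cost : ∀ k (step : Sem → Sem × ℕ) fuel s B → (∀ s → proj₂ (step s) ≤ B) →
                 proj₂ (iterate k step fuel s) ≤ fuel * (B + tableSize k)
  iterate-cost k step zero       s B step≤B = z≤n
  iterate-cost k step (suc fuel) s B step≤B with eqSem k (proj₁ (step s)) s
  ... | true  = ≤-trans (+-monoˡ-≤ (tableSize k) (step≤B s)) (m≤m+n _ _)
  ... | false = +-mono-≤ (+-monoˡ-≤ (tableSize k) (step≤B s)) (iterate-cost k step fuel (proj₁ (step s)) B step≤B)

  module _ (tr₁≤n : length tr₁ ≤ n) (tr₂≤n : length tr₂ ≤ n) where

    transCount≤n : ∀ i → transCount i ≤ n
    transCount≤n c₁ = tr₁≤n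
    transCount≤n c₂ = tr₂≤n

    MC-cost≤costBound : ∀ {m} (Φ : Fm Act m) ρ → proj₂ (MC Φ ρ) ≤ costBound Φ
    MC-cost≤costBound tt          ρ = ≤-refl
    MC-cost≤costBound (dia a i Φ) ρ = +-mono-≤ (MC-cost≤costBound Φ ρ) (*-monoʳ-≤ N (s≤s (transCount≤n i)))
    MC-cost≤costBound (neg Φ)     ρ = +-monoˡ-≤ N (MC-cost≤costBound Φ ρ)
    MC-cost≤costBound (conj Φ Ψ)  ρ = +-monoˡ-≤ N (+-mono-≤ (MC-cost≤costBound Φ ρ) (MC-cost≤costBound Ψ ρ))
    MC-cost≤costBound (var i)     ρ = ≤-refl
    MC-cost≤costBound (lam v Φ)   ρ = sum-map-≤-* allSets (λ T → MC-cost≤costBound Φ (set T ∷ ρ))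
    MC-cost≤costBound (mu τ Φ)    ρ =
      iterate-cost (length τ) _ (suc (tableSize (length τ))) (botSem (length τ)) (costBound Φ)
        (λ s → MC-cost≤costBound Φ (s ∷ ρ))
    MC-cost≤costBound (app Φ Ψ)   ρ = +-monoˡ-≤ N (+-mono-≤ (MC-cost≤costBound Φ ρ) (MC-cost≤costBound Ψ ρ))

  module _ (u : ℕ) (1≤u : 1 ≤ u) (N≤u : N ≤ u) (n≤u : n ≤ u) where

    Q : ℕ
    Q = 2 ^ u

    2≤Q : 2 ≤ Q
    2≤Q = ^-monoʳ-≤ 2 1≤u

    open PowerBounds u Q 2≤Q

    u≤Q : u ≤ Q
    u≤Q = <⇒≤ (n<2^n u)

    1+n≤Q : suc n ≤ Q
    1+n≤Q = ≤-trans (n<2^n n) (^-monoʳ-≤ 2 n≤u)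

    allSets≤Q : length allSets ≤ Q
    allSets≤Q = ≤-trans (≤-reflexive length-allSets) (^-monoʳ-≤ 2 N≤u)

    tableSize≤ : ∀ a → tableSize a ≤ u * Q ^ a
    tableSize≤ a = *-mono-≤ N≤u (^-monoˡ-≤ a allSets≤Q)

    1+tableSize≤ : ∀ a → suc (tableSize a) ≤ Q ^ suc (suc a)
    1+tableSize≤ a =
      ≤-trans (+-mono-≤ (m^n>0 Q (suc a)) (≤-trans (tableSize≤ a) (*-monoˡ-≤ (Q ^ a) u≤Q))) (^-double (suc a))

    unary-bound : ∀ {m} (Φ : Fm Act m) {c} → costBound Φ ≤ u * Q ^ costExponent (size Φ) 0 → c ≤ u * Q ^ 1 →
                  costBound Φ + c ≤ u * Q ^ costExponent (suc (size Φ)) 0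
    unary-bound Φ Φ≤ c≤ = raise (suc (costExponent (size Φ) 0 + 1))
      (+-bound (costExponent (size Φ) 0) 1 Φ≤ c≤)
      (costExponent-unary (size Φ) (1≤size Φ))

    binary-bound : ∀ {m} (Φ Ψ : Fm Act m) l → costBound Φ ≤ u * Q ^ costExponent (size Φ) (suc l) →
                   costBound Ψ ≤ u * Q ^ costExponent (size Ψ) 0 →
                   costBound Φ + costBound Ψ + N ≤ u * Q ^ costExponent (suc (size Φ + size Ψ)) l
    binary-bound Φ Ψ l Φ≤ Ψ≤ = raise (suc (suc (G₁ + G₂) + 0))
      (+-bound (suc (G₁ + G₂)) 0 (+-bound G₁ G₂ Φ≤ Ψ≤) (≤u⇒≤u*Q^ 0 N≤u))
      (costExponent-binary (size Φ) (size Ψ) l (1≤size Φ) (1≤size Ψ))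
      where
      G₁ G₂ : ℕ
      G₁ = costExponent (size Φ) (suc l)
      G₂ = costExponent (size Ψ) 0

    costBound≤ : ∀ {m} {Δ : Vec Ty m} {V} {Φ : Fm Act m} {τ} → Δ ∣ V ⊢ Φ ∶ τ →
                 costBound Φ ≤ u * Q ^ costExponent (size Φ) (length τ)
    costBound≤ t-tt = ≤u⇒≤u*Q^ (costExponent 1 0) N≤u
    costBound≤ (t-dia {Φ = Φ} d) =
      unary-bound Φ (costBound≤ d) (*-mono-≤ N≤u (≤-trans 1+n≤Q (≤-reflexive (sym (*-identityʳ Q)))))
    costBound≤ (t-neg {Φ = Φ} d) = unary-bound Φ (costBound≤ d) (≤u⇒≤u*Q^ 1 N≤u)
    costBound≤ (t-conj {Φ = Φ} {Ψ} d e) =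
      binary-bound Φ Ψ 0 (raise (costExponent (size Φ) 0) (costBound≤ d) (costExponent-monoʳ (size Φ) 0)) (costBound≤ e)
    costBound≤ {τ = τ} (t-var _ _) = ≤u⇒≤u*Q^ (costExponent 1 (length τ)) 1≤u
    costBound≤ (t-lam {σ = σ} {Φ} d) = raise (suc (costExponent (size Φ) (length σ)))
      (≤-trans (*-mono-≤ allSets≤Q (costBound≤ d)) (≤-reflexive (x∙yz≈y∙xz Q u _)))
      (costExponent-lam (size Φ) (length σ) (1≤size Φ))
    costBound≤ (t-mu {τ = τ} {Φ} d) = raise (suc (suc a) + suc (G + a))
      (≤-trans (*-mono-≤ (1+tableSize≤ a) (+-bound G a (costBound≤ d) (tableSize≤ a)))
        (≤-reflexive (trans (x∙yz≈y∙xz (Q ^ suc (suc a)) u _) (cong (u *_) (sym (^-distribˡ-+-* Q (suc (suc a)) _))))))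
      (costExponent-mu (size Φ) a (1≤size Φ))
      where
      a = length τ
      G = costExponent (size Φ) a
    costBound≤ (t-app+ {Φ = Φ} {Ψ} d e)   = binary-bound Φ Ψ _ (costBound≤ d) (costBound≤ e)
    costBound≤ (t-app- {Φ = Φ} {Ψ} d e)   = binary-bound Φ Ψ _ (costBound≤ d) (costBound≤ e)
    costBound≤ (t-app± {Φ = Φ} {Ψ} d e _) = binary-bound Φ Ψ _ (costBound≤ d) (costBound≤ e)

  MC-cost : ltsSize T₁ ≤ n → ltsSize T₂ ≤ n → 1 ≤ n → ∀ {Φ : Fm Act 0} → [] ∣ [] ⊢ Φ ∶ [] →
            proj₂ (MC Φ []) ≤ n ^ 2 * 2 ^ (n ^ 2 * size Φ ^ 2)
  MC-cost T₁≤n T₂≤n 1≤n {Φ} d = begin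
    proj₂ (MC Φ [])                                 ≤⟨ MC-cost≤costBound tr₁≤n tr₂≤n Φ [] ⟩
    costBound Φ                                     ≤⟨ costBound≤ (n ^ 2) 1≤n² N≤n² n≤n² d ⟩
    n ^ 2 * (2 ^ n ^ 2) ^ costExponent (size Φ) 0   ≡⟨ cong (n ^ 2 *_) (^-*-assoc 2 (n ^ 2) _) ⟩
    n ^ 2 * 2 ^ (n ^ 2 * costExponent (size Φ) 0)   ≡⟨ cong (λ e → n ^ 2 * 2 ^ (n ^ 2 * e)) (costExponent-closed (size Φ)) ⟩
    n ^ 2 * 2 ^ (n ^ 2 * size Φ ^ 2)                ∎
    where
    open ≤-Reasoning
    tr₁≤n : length tr₁ ≤ n
    tr₁≤n = ≤-trans (m≤n+m (length tr₁) n₁) T₁≤n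
    tr₂≤n : length tr₂ ≤ n
    tr₂≤n = ≤-trans (m≤n+m (length tr₂) n₂) T₂≤n
    n≤n*1 : n ≤ n * 1
    n≤n*1 = ≤-reflexive (sym (*-identityʳ n))
    1≤n² : 1 ≤ n ^ 2
    1≤n² = *-mono-≤ 1≤n (*-monoˡ-≤ 1 1≤n)
    N≤n² : N ≤ n ^ 2
    N≤n² = *-mono-≤ (≤-trans (m≤m+n n₁ (length tr₁)) T₁≤n)
                    (≤-trans (≤-trans (m≤m+n n₂ (length tr₂)) T₂≤n) n≤n*1)
    n≤n² : n ≤ n ^ 2
    n≤n² = ≤-trans n≤n*1 (*-monoʳ-≤ n (≤-trans 1≤n n≤n*1))

theorem1 : Σ ℕ λ c →
    (Act : Set) (_≟A_ : DecidableEquality Act) (k n : ℕ)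
    (Φ : Fm Act 0) (d : [] ∣ [] ⊢ Φ ∶ []) (T₁ T₂ : LTS Act) →
    size Φ ≡ k → ltsSize T₁ ≤ n → ltsSize T₂ ≤ n → 1 ≤ n →
    (Σ (Semantics.PSet _≟A_ T₁ T₂) λ S →
       proj₁ (Semantics.MC _≟A_ T₁ T₂ Φ []) ≡ Semantics.set S
       × Semantics.Den _≟A_ T₁ T₂ d tt S)
    × proj₂ (Semantics.MC _≟A_ T₁ T₂ Φ []) ≤ c * (n ^ 2 * 2 ^ (n ^ 2 * k ^ 2))
theorem1 = 1 , λ { Act _≟A_ .(size Φ) n Φ d T₁ T₂ refl T₁≤n T₂≤n 1≤n →
  Correctness.MC-correct _≟A_ T₁ T₂ d ,
  ≤-trans (Cost.MC-cost _≟A_ T₁ T₂ n T₁≤n T₂≤n 1≤n d) (≤-reflexive (sym (*-identityˡ _))) }
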